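{- Let $r\ge3$ and $n\ge2$ be integers, with $X_\ell=\{1,\dots,n\}$ for all $1\le\ell\le r$. Let $\mathcal{F}\subseteq X_1\times\dots\times X_r$ be coordinate-wise shifted, $1$-intersecting with $|\bigcap\mathcal{F}|<1$, and of maximum size among such families. Then $|\mathcal{F}|\le n^{r-1}-(n-1)^{r-1}+n-1$.
   Context: For $A\in X_1\times\dots\times X_r$, $A[\ell]$ is its $\ell$-th coordinate; $A\cap B=\{\ell:A[\ell]=B[\ell]\}$. $\mathcal{F}$ is $1$-intersecting (intersecting) if $|A\cap B|\ge1$ for all $A,B\in\mathcal{F}$; $\bigcap\mathcal{F}$ is the set of $\ell\in[r]$ such that all members of $\mathcal{F}$ have the same $\ell$-th coordinate, so $|\bigcap\mathcal{F}|<1$ means no coordinate is constant on $\mathcal{F}$. Shifts: for $\ell\in[r]$ and $1<j\le n$, given $\mathcal{F}$, for $A\in\mathcal{F}$ let $A'$ be $A$ with its $\ell$-th coordinate replaced by $1$; $S^{(\ell)}_j(A)=A'$ if $A[\ell]=j$ and $A'\notin\mathcal{F}$, else $S^{(\ell)}_j(A)=A$; $S^{(\ell)}_j(\mathcal{F})=\{S^{(\ell)}_j(A):A\in\mathcal{F}\}$. $\mathcal{F}$ is coordinate-wise shifted if $S^{(\ell)}_j(\mathcal{F})=\mathcal{F}$ for all $\ell\in[r]$ and all $1<j\le n$. -}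

module Defs where

open import Data.Nat using (ℕ; zero; suc; _<_; NonZero; >-nonZero⁻¹)
open import Data.Fin using (Fin; toℕ; fromℕ<)
import Data.Fin.Properties as FinP
open import Data.Vec using (Vec; lookup; _[_]≔_)
import Data.Vec.Properties as VecP
open import Data.List using (List; length; filter; map)
open import Data.List.Base using (allFin)
open import Data.List.Membership.Propositional using (_∈_)
open import Data.List.Relation.Unary.All using (all?)
open import Relation.Nullary using (yes; no; ¬_)
open import Relation.Binary.PropositionalEquality using (_≡_)
open import Data.Product using (_×_)
import Data.List.Membership.DecPropositional as DecMem

-- An element A of X_1 × … × X_r with X_ℓ = {1,…,n}; the value i ∈ {1,…,n}
-- is represented by the element of Fin n with toℕ = i - 1.
Tuple : ℕ → ℕ → Set
Tuple r n = Vec (Fin n) r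

-- A family is a finite set of tuples, given as a duplicate-free list
-- (duplicate-freeness is imposed separately via Unique where needed).
Family : ℕ → ℕ → Set
Family r n = List (Tuple r n)

private
  _≟T_ : ∀ {r n} (A B : Tuple r n) → Relation.Nullary.Dec (A ≡ B)
  _≟T_ = VecP.≡-dec FinP._≟_

_∈?_ : ∀ {r n} (A : Tuple r n) (F : Family r n) → Relation.Nullary.Dec (A ∈ F)
_∈?_ = DecMem._∈?_ _≟T_

_∩_ : ∀ {r n} → Tuple r n → Tuple r n → List (Fin r)
A ∩ B = filter (λ ℓ → lookup A ℓ FinP.≟ lookup B ℓ) (allFin _)

Intersecting : ∀ {r n} → Family r n → Set
Intersecting F = ∀ A B → A ∈ F → B ∈ F → 1 Data.Nat.≤ length (A ∩ B)

⋂ : ∀ {r n} → Family r n → List (Fin r)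
⋂ F = filter (λ ℓ → all? (λ A → all? (λ B → lookup A ℓ FinP.≟ lookup B ℓ) F) F) (allFin _)

one : ∀ {n} → .{{NonZero n}} → Fin n
one {n} = fromℕ< (>-nonZero⁻¹ n)

reset : ∀ {r n} → .{{NonZero n}} → Fin r → Tuple r n → Tuple r n
reset ℓ A = A [ ℓ ]≔ one

shiftElem : ∀ {r n} → .{{NonZero n}} → Fin r → Fin n → Family r n → Tuple r n → Tuple r n
shiftElem ℓ j F A with lookup A ℓ FinP.≟ j | reset ℓ A ∈? F
... | yes _ | no _ = reset ℓ A
... | _     | _    = A

shift : ∀ {r n} → .{{NonZero n}} → Fin r → Fin n → Family r n → Family r n
shift ℓ j F = map (shiftElem ℓ j F) F

_≈F_ : ∀ {r n} → Family r n → Family r n → Set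
F ≈F G = ∀ A → (A ∈ F → A ∈ G) × (A ∈ G → A ∈ F)

-- coordinate-wise shifted: S^{(ℓ)}_j(F) = F for all ℓ and all 1 < j ≤ n
-- (j > 1 in {1,…,n} corresponds to toℕ j ≥ 1)
Shifted : ∀ {r n} → .{{NonZero n}} → Family r n → Set
Shifted {r} {n} F = (ℓ : Fin r) (j : Fin n) → 0 < toℕ j → shift ℓ j F ≈F F

-- Record a tuple A ∈ {1,…,n}^r by the set ones A of coordinates where A is 1. In a shifted
-- intersecting family any two members are both 1 at some coordinate (reset to 1, in one of
-- them, every coordinate where the other is not 1), so the up-closure 𝒯 of {ones A : A ∈ F} is
-- an intersecting up-set; it contains every co-singleton because no coordinate is constant on F.
-- Weighting s ⊆ [r] by (n-1)^(r-∣s∣), the number of tuples A with ones A = s, gives ∣F∣ ≤ w 𝒯.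
-- Splitting 𝒯 on the first coordinate into its links 𝒜 ⊇ ℬ gives
-- w 𝒯 = w 𝒜 + (n-1) w ℬ = w 𝒜 + w ℬ + (n-2) w (𝒜 ∩ ℬ), where 𝒜, ℬ are cross-intersecting
-- up-sets on [r-1], both containing [r-1], whose common members have at least two elements.
-- For such pairs on [M],
--   w 𝒜 + w ℬ + (n-2) w (𝒜 ∩ ℬ) + (n-1)^M ≤ n^M + n - 1
-- by induction on M: splitting on a coordinate x, the pairs (𝒜 with x, ℬ without x),
-- (𝒜 without x, ℬ with x) and (meet of the links with x, join of the links without x) again
-- satisfy the hypotheses, while the degenerate cases reduce to the companion bound
--   w 𝒜 + w ℬ + (n-1)^M ≤ n^M + 1
-- for all cross-intersecting up-sets containing [M], proved by a similar induction.
module Submission where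

open import Data.Bool.Base using (Bool; true; false; not; T; _∧_; _∨_; if_then_else_; f≤t; b≤b)
  renaming (_≤_ to _≤ᵇ_)
open import Data.Bool.Properties using (T-∧; T-∨; ∧-comm; ≤-maximum)
open import Data.Empty using (⊥-elim)
open import Data.Fin.Base using (Fin; zero; suc)
open import Data.Fin.Properties as FinP using (any?)
open import Data.Fin.Subset using (inside; outside; ⁅_⁆; ∁; _⊆_)
open import Data.Fin.Subset.Properties using (_⊆?_)
open import Data.List.Base
  using (List; []; _∷_; [_]; length; map; _++_; cartesianProductWith; allFin; filter; foldr)
open import Data.List.Properties using (length-++; length-map; length-tabulate; length-removeAt′)
open import Data.List.Membership.Propositional using (_∈_; _∉_; _─_; find; lose)
open import Data.List.Membership.Propositional.Properties
  using (∈-map⁺; ∈-++⁺ˡ; ∈-++⁺ʳ; ∈-allFin; ∈-filter⁺; ∈-filter⁻; ∈-cartesianProductWith⁺; ∈-length)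
import Data.List.Relation.Unary.All as All
import Data.List.Relation.Unary.Any as Any
open import Data.List.Relation.Unary.AllPairs using (_∷_)
open import Data.List.Relation.Unary.Unique.Propositional using (Unique)
open import Data.Nat.Base using (ℕ; zero; suc; _+_; _*_; _∸_; _^_; _≤_; _<_; z≤n; s≤s; NonZero)
open import Data.Nat.Properties
open import Data.Nat.Tactic.RingSolver using (solve-∀)
open import Data.Product.Base using (∃; _×_; _,_; proj₁; proj₂)
open import Data.Sum.Base using (_⊎_; inj₁; inj₂)
open import Data.Vec.Base using (Vec; []; _∷_; insertAt; lookup; _[_]≔_)
open import Data.Vec.Properties using (map-replicate; lookup∘update; lookup∘update′; []≔-lookup)
open import Function.Base using (_∘_)
open import Function.Bundles using (module Equivalence)
open Equivalence using (to; from)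
open import Relation.Binary.PropositionalEquality
  using (_≡_; _≢_; refl; sym; trans; cong; cong₂; subst; module ≡-Reasoning)
open import Relation.Nullary using (¬_; ¬?; yes; no; contradiction)
open import Relation.Nullary.Decidable using (T?; ⌊_⌋; toWitness; fromWitness; decidable-stable)

open import Defs hiding (_∩_)

module SetSystems where

  open import Data.Fin.Subset hiding (⋂)
  open import Data.Vec.Base using (here; there)
  open import Data.Fin.Subset.Properties
    using (s⊆s; out⊆; drop-∷-⊆; ⊆-refl; ⊆⊤; ⊥⊆; ∉⊥; x∈p∩q⁺; x∈p∩q⁻; ∩-comm;
           x∈p⇒x∉∁p; ∣⁅x⁆∣≡1; ∣∁p∣≡n∸∣p∣)

  private
    variable
      M : ℕ
      b c : Side
      s t s′ t′ : Subset M

  ∁⊥≡⊤ : ∁ ⊥ ≡ ⊤ {M}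
  ∁⊥≡⊤ {M} = map-replicate not outside M

  ∷-⊆ : b ≤ᵇ c → s ⊆ t → b ∷ s ⊆ c ∷ t
  ∷-⊆ b≤b = s⊆s
  ∷-⊆ f≤t = out⊆

  insertAt-⊆ : ∀ x → b ≤ᵇ c → s ⊆ t → insertAt s x b ⊆ insertAt t x c
  insertAt-⊆ zero b≤c s⊆t = ∷-⊆ b≤c s⊆t
  insertAt-⊆ {s = _ ∷ _} {t = _ ∷ _} (suc x) b≤c s⊆t here with s⊆t here
  ... | here = here
  insertAt-⊆ {s = _ ∷ _} {t = _ ∷ _} (suc x) b≤c s⊆t (there y∈) =
    there (insertAt-⊆ x b≤c (drop-∷-⊆ s⊆t) y∈)

  insertAt-∩ : ∀ x (s t : Subset M) → insertAt s x b ∩ insertAt t x c ≡ insertAt (s ∩ t) x (b ∧ c)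
  insertAt-∩ zero s t = refl
  insertAt-∩ (suc x) (a ∷ s) (a′ ∷ t) = cong (a ∧ a′ ∷_) (insertAt-∩ x s t)

  Nonempty-insertAt⁻ : ∀ x (s : Subset M) → Nonempty (insertAt s x outside) → Nonempty s
  Nonempty-insertAt⁻ zero s (suc y , there y∈) = y , y∈
  Nonempty-insertAt⁻ (suc x) (a ∷ s) (zero , here) = zero , here
  Nonempty-insertAt⁻ (suc x) (a ∷ s) (suc y , there y∈) =
    let z , z∈ = Nonempty-insertAt⁻ x s (y , y∈) in suc z , there z∈

  Nonempty-∩-mono : s ⊆ s′ → t ⊆ t′ → Nonempty (s ∩ t) → Nonempty (s′ ∩ t′)
  Nonempty-∩-mono s⊆s′ t⊆t′ (y , y∈s∩t) =
    let y∈s , y∈t = x∈p∩q⁻ _ _ y∈s∩t in y , x∈p∩q⁺ (s⊆s′ y∈s , t⊆t′ y∈t)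

  ⊥∩-Empty : ∀ (t : Subset M) → ¬ Nonempty (⊥ ∩ t)
  ⊥∩-Empty t (y , y∈) = ∉⊥ (proj₁ (x∈p∩q⁻ ⊥ t y∈))

  ⁅x⁆∩∁⁅x⁆-Empty : ∀ (x : Fin M) → ¬ Nonempty (⁅ x ⁆ ∩ ∁ ⁅ x ⁆)
  ⁅x⁆∩∁⁅x⁆-Empty x (y , y∈) = let y∈⁅x⁆ , y∈∁⁅x⁆ = x∈p∩q⁻ _ _ y∈ in x∈p⇒x∉∁p y∈⁅x⁆ y∈∁⁅x⁆

  ⁅x⁆≡insertAt⊥ : ∀ (x : Fin (suc M)) → ⁅ x ⁆ ≡ insertAt ⊥ x inside
  ⁅x⁆≡insertAt⊥ zero = refl
  ⁅x⁆≡insertAt⊥ {suc M} (suc x) = cong (outside ∷_) (⁅x⁆≡insertAt⊥ x)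

  ∁⁅x⁆≡insertAt⊤ : ∀ (x : Fin (suc M)) → ∁ ⁅ x ⁆ ≡ insertAt ⊤ x outside
  ∁⁅x⁆≡insertAt⊤ zero = cong (outside ∷_) ∁⊥≡⊤
  ∁⁅x⁆≡insertAt⊤ {suc M} (suc x) = cong (inside ∷_) (∁⁅x⁆≡insertAt⊤ x)

  insertAt⊤≡⊤ : ∀ (x : Fin (suc M)) → insertAt ⊤ x inside ≡ ⊤
  insertAt⊤≡⊤ zero = refl
  insertAt⊤≡⊤ {suc M} (suc x) = cong (inside ∷_) (insertAt⊤≡⊤ x)

  ≡⊤⊎⊆∁⁅⁆ : ∀ (s : Subset M) → s ≡ ⊤ ⊎ ∃ λ x → s ⊆ ∁ ⁅ x ⁆
  ≡⊤⊎⊆∁⁅⁆ [] = inj₁ refl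
  ≡⊤⊎⊆∁⁅⁆ (outside ∷ s) = inj₂ (zero , out⊆ (subst (s ⊆_) (sym ∁⊥≡⊤) ⊆⊤))
  ≡⊤⊎⊆∁⁅⁆ (inside ∷ s) with ≡⊤⊎⊆∁⁅⁆ s
  ... | inj₁ s≡⊤ = inj₁ (cong (inside ∷_) s≡⊤)
  ... | inj₂ (x , s⊆∁⁅x⁆) = inj₂ (suc x , s⊆s s⊆∁⁅x⁆)

  ∣insertAt-outside∣ : ∀ x (s : Subset M) → ∣ insertAt s x outside ∣ ≡ ∣ s ∣
  ∣insertAt-outside∣ zero s = refl
  ∣insertAt-outside∣ (suc x) (inside ∷ s) = cong suc (∣insertAt-outside∣ x s)
  ∣insertAt-outside∣ (suc x) (outside ∷ s) = ∣insertAt-outside∣ x s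

  ∣∁⁅x⁆∣≡n∸1 : ∀ (x : Fin (suc M)) → ∣ ∁ ⁅ x ⁆ ∣ ≡ suc M ∸ 1
  ∣∁⁅x⁆∣≡n∸1 {M} x = trans (∣∁p∣≡n∸∣p∣ ⁅ x ⁆) (cong (suc M ∸_) (∣⁅x⁆∣≡1 x))

  ∣p∣≡0⇒p≡⊥ : ∀ (s : Subset M) → ∣ s ∣ ≡ 0 → s ≡ ⊥
  ∣p∣≡0⇒p≡⊥ [] _ = refl
  ∣p∣≡0⇒p≡⊥ (outside ∷ s) ∣s∣≡0 = cong (outside ∷_) (∣p∣≡0⇒p≡⊥ s ∣s∣≡0)

  ∣p∣≤1⇒p≡⊥⊎⁅⁆ : ∀ (s : Subset M) → ∣ s ∣ ≤ 1 → s ≡ ⊥ ⊎ ∃ λ y → s ≡ ⁅ y ⁆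
  ∣p∣≤1⇒p≡⊥⊎⁅⁆ [] _ = inj₁ refl
  ∣p∣≤1⇒p≡⊥⊎⁅⁆ (inside ∷ s) (s≤s ∣s∣≤0) = inj₂ (zero , cong (inside ∷_) (∣p∣≡0⇒p≡⊥ s (n≤0⇒n≡0 ∣s∣≤0)))
  ∣p∣≤1⇒p≡⊥⊎⁅⁆ (outside ∷ s) ∣s∣≤1 with ∣p∣≤1⇒p≡⊥⊎⁅⁆ s ∣s∣≤1
  ... | inj₁ s≡⊥ = inj₁ (cong (outside ∷_) s≡⊥)
  ... | inj₂ (y , s≡⁅y⁆) = inj₂ (suc y , cong (outside ∷_) s≡⁅y⁆)

  isOne : ∀ {n} → Fin n → Side
  isOne zero    = inside
  isOne (suc _) = outside

  ones : ∀ {n} → Vec (Fin n) M → Subset M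
  ones []      = []
  ones (a ∷ A) = isOne a ∷ ones A

  ones-∩-Nonempty : ∀ {n} (A B : Vec (Fin (suc n)) M) ℓ → lookup A ℓ ≡ zero → lookup B ℓ ≡ zero →
                    Nonempty (ones A ∩ ones B)
  ones-∩-Nonempty (_ ∷ _) (_ ∷ _) zero refl refl = zero , here
  ones-∩-Nonempty (_ ∷ A) (_ ∷ B) (suc ℓ) Aℓ≡0 Bℓ≡0 =
    let y , y∈ = ones-∩-Nonempty A B ℓ Aℓ≡0 Bℓ≡0 in suc y , there y∈

  ones⊆∁⁅⁆ : ∀ {n} (A : Vec (Fin (suc n)) M) ℓ → lookup A ℓ ≢ zero → ones A ⊆ ∁ ⁅ ℓ ⁆
  ones⊆∁⁅⁆ (zero ∷ _) zero Aℓ≢0 = contradiction refl Aℓ≢0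
  ones⊆∁⁅⁆ (suc _ ∷ A) zero _ = out⊆ (subst (ones A ⊆_) (sym ∁⊥≡⊤) ⊆⊤)
  ones⊆∁⁅⁆ (a ∷ A) (suc ℓ) Aℓ≢0 = ∷-⊆ (≤-maximum (isOne a)) (ones⊆∁⁅⁆ A ℓ Aℓ≢0)

  SetSystem : ℕ → Set
  SetSystem M = Subset M → Bool

  infixl 9 _⟨_≔_⟩
  infixr 7 _∩ᶠ_
  infixr 6 _∪ᶠ_
  infix 4 _⊆ᶠ_

  _⟨_≔_⟩ : SetSystem (suc M) → Fin (suc M) → Side → SetSystem M
  (X ⟨ x ≔ b ⟩) s = X (insertAt s x b)

  _∩ᶠ_ _∪ᶠ_ : SetSystem M → SetSystem M → SetSystem M
  (X ∩ᶠ Y) s = X s ∧ Y s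
  (X ∪ᶠ Y) s = X s ∨ Y s

  _⊆ᶠ_ : SetSystem M → SetSystem M → Set
  X ⊆ᶠ Y = ∀ {s} → T (X s) → T (Y s)

  IsUpset : SetSystem M → Set
  IsUpset X = ∀ {s t} → s ⊆ t → T (X s) → T (X t)

  CrossIntersecting : SetSystem M → SetSystem M → Set
  CrossIntersecting X Y = ∀ {s t} → T (X s) → T (Y t) → Nonempty (s ∩ t)

  Sizes≥2 : SetSystem M → Set
  Sizes≥2 X = ∀ {s} → T (X s) → 2 ≤ ∣ s ∣

  ⟨≔⟩-upset : ∀ (X : SetSystem (suc M)) x → IsUpset X → IsUpset (X ⟨ x ≔ b ⟩)
  ⟨≔⟩-upset X x X↑ s⊆t = X↑ (insertAt-⊆ x b≤b s⊆t)

  ∩ᶠ-upset : ∀ (X Y : SetSystem M) → IsUpset X → IsUpset Y → IsUpset (X ∩ᶠ Y)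
  ∩ᶠ-upset X Y X↑ Y↑ s⊆t XYs =
    let Xs , Ys = to T-∧ XYs in from T-∧ (X↑ s⊆t Xs , Y↑ s⊆t Ys)

  ∪ᶠ-upset : ∀ (X Y : SetSystem M) → IsUpset X → IsUpset Y → IsUpset (X ∪ᶠ Y)
  ∪ᶠ-upset X Y X↑ Y↑ s⊆t XYs with to T-∨ XYs
  ... | inj₁ Xs = from T-∨ (inj₁ (X↑ s⊆t Xs))
  ... | inj₂ Ys = from T-∨ (inj₂ (Y↑ s⊆t Ys))

  ⟨outside⟩⊆⟨inside⟩ : ∀ (X : SetSystem (suc M)) x → IsUpset X → X ⟨ x ≔ outside ⟩ ⊆ᶠ X ⟨ x ≔ inside ⟩
  ⟨outside⟩⊆⟨inside⟩ X x X↑ = X↑ (insertAt-⊆ x f≤t ⊆-refl)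

  ⟨inside⟩∋⊤ : ∀ (X : SetSystem (suc M)) x → T (X ⊤) → T ((X ⟨ x ≔ inside ⟩) ⊤)
  ⟨inside⟩∋⊤ X x = subst (T ∘ X) (sym (insertAt⊤≡⊤ x))

  ⟨outside⟩∋⊤ : ∀ (X : SetSystem (suc M)) x → T (X (∁ ⁅ x ⁆)) → T ((X ⟨ x ≔ outside ⟩) ⊤)
  ⟨outside⟩∋⊤ X x = subst (T ∘ X) (∁⁅x⁆≡insertAt⊤ x)

  ∌∁⁅x⁆⇒⟨outside⟩-empty : ∀ (X : SetSystem (suc M)) x → IsUpset X → ¬ T (X (∁ ⁅ x ⁆)) →
                          ¬ T ((X ⟨ x ≔ outside ⟩) s)
  ∌∁⁅x⁆⇒⟨outside⟩-empty X x X↑ X∌∁⁅x⁆ Xs =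
    X∌∁⁅x⁆ (subst (T ∘ X) (sym (∁⁅x⁆≡insertAt⊤ x)) (X↑ (insertAt-⊆ x b≤b ⊆⊤) Xs))

  ∌∁⁅⁆⇒only-⊤ : ∀ (X : SetSystem M) → IsUpset X → (∀ x → ¬ T (X (∁ ⁅ x ⁆))) → T (X s) → s ≡ ⊤
  ∌∁⁅⁆⇒only-⊤ {s = s} X X↑ X∌∁⁅⁆ Xs with ≡⊤⊎⊆∁⁅⁆ s
  ... | inj₁ s≡⊤ = s≡⊤
  ... | inj₂ (x , s⊆∁⁅x⁆) = contradiction (X↑ s⊆∁⁅x⁆ Xs) (X∌∁⁅⁆ x)

  ∌⊥∌⁅⁆⇒sizes≥2 : ∀ (X : SetSystem M) → ¬ T (X ⊥) → (∀ y → ¬ T (X ⁅ y ⁆)) → Sizes≥2 X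
  ∌⊥∌⁅⁆⇒sizes≥2 X X∌⊥ X∌⁅⁆ {s} Xs with 2 ≤? ∣ s ∣
  ... | yes 2≤∣s∣ = 2≤∣s∣
  ... | no 2≰∣s∣ with ∣p∣≤1⇒p≡⊥⊎⁅⁆ s (≤-pred (≰⇒> 2≰∣s∣))
  ...   | inj₁ refl = contradiction Xs X∌⊥
  ...   | inj₂ (y , refl) = contradiction Xs (X∌⁅⁆ y)

  sizes≥2⇒∌⁅⁆ : ∀ (X : SetSystem M) → Sizes≥2 X → ∀ y → ¬ T (X ⁅ y ⁆)
  sizes≥2⇒∌⁅⁆ X X≥2 y X∋⁅y⁆ with subst (2 ≤_) (∣⁅x⁆∣≡1 y) (X≥2 X∋⁅y⁆)
  ... | s≤s ()

  ⟨outside⟩-sizes≥2 : ∀ (X : SetSystem (suc M)) x → Sizes≥2 X → Sizes≥2 (X ⟨ x ≔ outside ⟩)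
  ⟨outside⟩-sizes≥2 X x X≥2 {s} Xs = subst (2 ≤_) (∣insertAt-outside∣ x s) (X≥2 Xs)

  cross-sym : ∀ (X Y : SetSystem M) → CrossIntersecting X Y → CrossIntersecting Y X
  cross-sym X Y X×Y Ys Xt = subst Nonempty (∩-comm _ _) (X×Y Xt Ys)

  ⟨≔⟩-cross : ∀ (X Y : SetSystem (suc M)) x → b ∧ c ≡ outside → CrossIntersecting X Y →
              CrossIntersecting (X ⟨ x ≔ b ⟩) (Y ⟨ x ≔ c ⟩)
  ⟨≔⟩-cross X Y x b∧c≡outside X×Y {s} {t} Xs Yt =
    Nonempty-insertAt⁻ x (s ∩ t)
      (subst Nonempty (trans (insertAt-∩ x s t) (cong (insertAt (s ∩ t) x) b∧c≡outside)) (X×Y Xs Yt))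

  cross-∋⊤⇒∌⊥ : ∀ (X Y : SetSystem M) → CrossIntersecting X Y → T (Y ⊤) → ¬ T (X ⊥)
  cross-∋⊤⇒∌⊥ X Y X×Y Y∋⊤ X∋⊥ = ⊥∩-Empty ⊤ (X×Y X∋⊥ Y∋⊤)

  cross-∋⁅y⁆⇒⟨outside⟩-empty : ∀ (X Y : SetSystem (suc M)) y → CrossIntersecting X Y → T (Y ⁅ y ⁆) →
                               ¬ T ((X ⟨ y ≔ outside ⟩) s)
  cross-∋⁅y⁆⇒⟨outside⟩-empty {s = s} X Y y X×Y Y∋⁅y⁆ Xs =
    ⊥∩-Empty s (subst Nonempty (∩-comm s ⊥)
      (⟨≔⟩-cross X Y y refl X×Y Xs (subst (T ∘ Y) (⁅x⁆≡insertAt⊥ y) Y∋⁅y⁆)))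

  intersecting-∋∁⁅⁆⇒sizes≥2 : ∀ (X : SetSystem M) → CrossIntersecting X X → (∀ x → T (X (∁ ⁅ x ⁆))) →
                              Sizes≥2 X
  intersecting-∋∁⁅⁆⇒sizes≥2 X X×X X∋∁⁅⁆ =
    ∌⊥∌⁅⁆⇒sizes≥2 X (λ X∋⊥ → ⊥∩-Empty ⊥ (X×X X∋⊥ X∋⊥))
                    (λ y X∋⁅y⁆ → ⁅x⁆∩∁⁅x⁆-Empty y (X×X X∋⁅y⁆ (X∋∁⁅⁆ y)))

  record CrossUpsets (X Y : SetSystem M) : Set where
    field
      upsetˡ : IsUpset X
      upsetʳ : IsUpset Y
      cross  : CrossIntersecting X Y
      ⊤∈ˡ    : T (X ⊤)
      ⊤∈ʳ    : T (Y ⊤)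

  module _ {X Y : SetSystem M} (P : CrossUpsets X Y) where
    open CrossUpsets P

    swap : CrossUpsets Y X
    swap = record
      { upsetˡ = upsetʳ ; upsetʳ = upsetˡ ; cross = cross-sym X Y cross ; ⊤∈ˡ = ⊤∈ʳ ; ⊤∈ʳ = ⊤∈ˡ }

  module _ {X Y : SetSystem (suc M)} (P : CrossUpsets X Y) where
    open CrossUpsets P

    restrict : ∀ x → b ∧ c ≡ outside → T ((X ⟨ x ≔ b ⟩) ⊤) → T ((Y ⟨ x ≔ c ⟩) ⊤) →
               CrossUpsets (X ⟨ x ≔ b ⟩) (Y ⟨ x ≔ c ⟩)
    restrict x b∧c≡outside X∋⊤ Y∋⊤ = record
      { upsetˡ = ⟨≔⟩-upset X x upsetˡ ; upsetʳ = ⟨≔⟩-upset Y x upsetʳ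
      ; cross = ⟨≔⟩-cross X Y x b∧c≡outside cross ; ⊤∈ˡ = X∋⊤ ; ⊤∈ʳ = Y∋⊤ }

    restrict-∩∪ : ∀ x → T (X (∁ ⁅ x ⁆)) →
                  CrossUpsets (X ⟨ x ≔ inside ⟩ ∩ᶠ Y ⟨ x ≔ inside ⟩)
                              (X ⟨ x ≔ outside ⟩ ∪ᶠ Y ⟨ x ≔ outside ⟩)
    restrict-∩∪ x X∋∁⁅x⁆ = record
      { upsetˡ = ∩ᶠ-upset X₁ Y₁ (⟨≔⟩-upset X x upsetˡ) (⟨≔⟩-upset Y x upsetʳ)
      ; upsetʳ = ∪ᶠ-upset X₀ Y₀ (⟨≔⟩-upset X x upsetˡ) (⟨≔⟩-upset Y x upsetʳ)
      ; cross  = cross-∩∪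
      ; ⊤∈ˡ    = from T-∧ (⟨inside⟩∋⊤ X x ⊤∈ˡ , ⟨inside⟩∋⊤ Y x ⊤∈ʳ)
      ; ⊤∈ʳ    = from T-∨ (inj₁ (⟨outside⟩∋⊤ X x X∋∁⁅x⁆))
      }
      where
      X₀ X₁ Y₀ Y₁ : SetSystem _
      X₀ = X ⟨ x ≔ outside ⟩
      X₁ = X ⟨ x ≔ inside ⟩
      Y₀ = Y ⟨ x ≔ outside ⟩
      Y₁ = Y ⟨ x ≔ inside ⟩
      cross-∩∪ : CrossIntersecting (X₁ ∩ᶠ Y₁) (X₀ ∪ᶠ Y₀)
      cross-∩∪ XY₁s XY₀t with to T-∨ XY₀t
      ... | inj₁ X₀t = ⟨≔⟩-cross Y X x refl (cross-sym X Y cross) (proj₂ (to T-∧ XY₁s)) X₀t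
      ... | inj₂ Y₀t = ⟨≔⟩-cross X Y x refl cross (proj₁ (to T-∧ XY₁s)) Y₀t

  module Weight (q : ℕ) where

    n : ℕ
    n = suc q

    -- weight X is the sum over s ∈ X of q ^ (M ∸ ∣ s ∣), the number of points of {1,…,n}^M
    -- whose coordinates equal to 1 are exactly those in s.
    weight : SetSystem M → ℕ
    weight {zero}  X = if X [] then 1 else 0
    weight {suc M} X = q * weight (X ⟨ zero ≔ outside ⟩) + weight (X ⟨ zero ≔ inside ⟩)

    weight-split : ∀ (X : SetSystem (suc M)) x →
                   weight X ≡ q * weight (X ⟨ x ≔ outside ⟩) + weight (X ⟨ x ≔ inside ⟩)
    weight-split X zero = refl
    weight-split {suc M} X (suc x) =
      trans (cong₂ (λ u v → q * u + v) (weight-split X₀ x) (weight-split X₁ x))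
            (interchange q (weight (X₀ ⟨ x ≔ outside ⟩)) (weight (X₀ ⟨ x ≔ inside ⟩))
                         (weight (X₁ ⟨ x ≔ outside ⟩)) (weight (X₁ ⟨ x ≔ inside ⟩)))
      where
      X₀ X₁ : SetSystem (suc M)
      X₀ = X ⟨ zero ≔ outside ⟩
      X₁ = X ⟨ zero ≔ inside ⟩
      interchange : ∀ q a b c d → q * (q * a + b) + (q * c + d) ≡ q * (q * a + c) + (q * b + d)
      interchange = solve-∀

    weight-mono : ∀ (X Y : SetSystem M) → X ⊆ᶠ Y → weight X ≤ weight Y
    weight-mono {zero} X Y X⊆Y with X [] | Y [] | X⊆Y {[]}
    ... | false | _     | _      = z≤n
    ... | true  | true  | _      = ≤-refl
    ... | true  | false | X⊆Y[] = ⊥-elim (X⊆Y[] _)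
    weight-mono {suc M} X Y X⊆Y =
      +-mono-≤ (*-monoʳ-≤ q (weight-mono (X ⟨ zero ≔ outside ⟩) (Y ⟨ zero ≔ outside ⟩) X⊆Y))
               (weight-mono (X ⟨ zero ≔ inside ⟩) (Y ⟨ zero ≔ inside ⟩) X⊆Y)

    weight-cong : ∀ (X Y : SetSystem M) → (∀ s → X s ≡ Y s) → weight X ≡ weight Y
    weight-cong X Y X≗Y = ≤-antisym (weight-mono X Y (λ {s} → subst T (X≗Y s)))
                                    (weight-mono Y X (λ {s} → subst T (sym (X≗Y s))))

    weight-modular : ∀ (X Y : SetSystem M) → weight (X ∪ᶠ Y) + weight (X ∩ᶠ Y) ≡ weight X + weight Y
    weight-modular {zero} X Y with X [] | Y []
    ... | true  | true  = refl
    ... | true  | false = refl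
    ... | false | true  = refl
    ... | false | false = refl
    weight-modular {suc M} X Y = begin
      (q * weight (X₀ ∪ᶠ Y₀) + weight (X₁ ∪ᶠ Y₁)) + (q * weight (X₀ ∩ᶠ Y₀) + weight (X₁ ∩ᶠ Y₁))
        ≡⟨ regroup q _ _ _ _ ⟩
      q * (weight (X₀ ∪ᶠ Y₀) + weight (X₀ ∩ᶠ Y₀)) + (weight (X₁ ∪ᶠ Y₁) + weight (X₁ ∩ᶠ Y₁))
        ≡⟨ cong₂ (λ u v → q * u + v) (weight-modular X₀ Y₀) (weight-modular X₁ Y₁) ⟩
      q * (weight X₀ + weight Y₀) + (weight X₁ + weight Y₁)
        ≡⟨ regroup q _ _ _ _ ⟨
      (q * weight X₀ + weight X₁) + (q * weight Y₀ + weight Y₁)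
        ∎
      where
      open ≡-Reasoning
      X₀ X₁ Y₀ Y₁ : SetSystem M
      X₀ = X ⟨ zero ≔ outside ⟩
      X₁ = X ⟨ zero ≔ inside ⟩
      Y₀ = Y ⟨ zero ≔ outside ⟩
      Y₁ = Y ⟨ zero ≔ inside ⟩
      regroup : ∀ q a b c d → (q * a + b) + (q * c + d) ≡ q * (a + c) + (b + d)
      regroup = solve-∀

    weight-full : ∀ M → weight {M} (λ _ → true) ≡ n ^ M
    weight-full zero = refl
    weight-full (suc M) rewrite weight-full M = +-comm (q * n ^ M) (n ^ M)

    weight≤n^M : ∀ (X : SetSystem M) → weight X ≤ n ^ M
    weight≤n^M {M} X = ≤-trans (weight-mono X (λ _ → true) _) (≤-reflexive (weight-full M))

    full⇒weight≡n^M : ∀ (X : SetSystem M) → (∀ s → T (X s)) → weight X ≡ n ^ M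
    full⇒weight≡n^M {M} X X∋ =
      ≤-antisym (weight≤n^M X)
                (≤-trans (≤-reflexive (sym (weight-full M))) (weight-mono _ X (λ {s} _ → X∋ s)))

    empty⇒weight≡0 : ∀ (X : SetSystem M) → (∀ {s} → ¬ T (X s)) → weight X ≡ 0
    empty⇒weight≡0 {zero} X X∅ with X [] | X∅ {[]}
    ... | false | _   = refl
    ... | true  | ∌[] = ⊥-elim (∌[] _)
    empty⇒weight≡0 {suc M} X X∅
      rewrite empty⇒weight≡0 (X ⟨ zero ≔ outside ⟩) X∅ | empty⇒weight≡0 (X ⟨ zero ≔ inside ⟩) X∅ =
      trans (+-identityʳ (q * 0)) (*-zeroʳ q)

    ∌⊥⇒weight+q^M≤n^M : ∀ (X : SetSystem M) → ¬ T (X ⊥) → weight X + q ^ M ≤ n ^ M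
    ∌⊥⇒weight+q^M≤n^M {zero} X X∌⊥ with X [] | X∌⊥
    ... | false | _   = ≤-refl
    ... | true  | ∌[] = ⊥-elim (∌[] _)
    ∌⊥⇒weight+q^M≤n^M {suc M} X X∌⊥ = begin
      q * weight X₀ + weight X₁ + q * q ^ M
        ≡⟨ regroup q (weight X₀) (weight X₁) (q ^ M) ⟩
      q * (weight X₀ + q ^ M) + weight X₁
        ≤⟨ +-mono-≤ (*-monoʳ-≤ q (∌⊥⇒weight+q^M≤n^M X₀ X∌⊥)) (weight≤n^M X₁) ⟩
      q * n ^ M + n ^ M
        ≡⟨ +-comm (q * n ^ M) (n ^ M) ⟩
      n ^ suc M ∎
      where
      open ≤-Reasoning
      X₀ X₁ : SetSystem M
      X₀ = X ⟨ zero ≔ outside ⟩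
      X₁ = X ⟨ zero ≔ inside ⟩
      regroup : ∀ q a b c → q * a + b + q * c ≡ q * (a + c) + b
      regroup = solve-∀

    only-⊤⇒weight≤1 : ∀ (X : SetSystem M) → (∀ {s} → T (X s) → s ≡ ⊤) → weight X ≤ 1
    only-⊤⇒weight≤1 {zero} X _ with X []
    ... | true  = ≤-refl
    ... | false = z≤n
    only-⊤⇒weight≤1 {suc M} X X⊆⊤ =
      subst (λ w → q * w + weight X₁ ≤ 1) (sym (empty⇒weight≡0 X₀ X₀-empty))
        (subst (λ w → w + weight X₁ ≤ 1) (sym (*-zeroʳ q)) (only-⊤⇒weight≤1 X₁ (tail-≡ ∘ X⊆⊤)))
      where
      X₀ X₁ : SetSystem M
      X₀ = X ⟨ zero ≔ outside ⟩
      X₁ = X ⟨ zero ≔ inside ⟩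
      X₀-empty : ∀ {s} → ¬ T (X₀ s)
      X₀-empty X₀s with X⊆⊤ X₀s
      ... | ()
      tail-≡ : ∀ {s : Subset M} → inside ∷ s ≡ ⊤ → s ≡ ⊤
      tail-≡ refl = refl

    weight-⟨outside⟩-empty : ∀ (X : SetSystem (suc M)) x → (∀ {s} → ¬ T ((X ⟨ x ≔ outside ⟩) s)) →
                             weight X ≡ weight (X ⟨ x ≔ inside ⟩)
    weight-⟨outside⟩-empty X x X₀-empty = begin
      weight X                  ≡⟨ weight-split X x ⟩
      q * weight X₀ + weight X₁ ≡⟨ cong (λ w → q * w + weight X₁) (empty⇒weight≡0 X₀ X₀-empty) ⟩
      q * 0 + weight X₁         ≡⟨ cong (_+ weight X₁) (*-zeroʳ q) ⟩
      weight X₁                 ∎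
      where
      open ≡-Reasoning
      X₀ X₁ : SetSystem _
      X₀ = X ⟨ x ≔ outside ⟩
      X₁ = X ⟨ x ≔ inside ⟩

  module Bounds (k : ℕ) where

    q : ℕ
    q = suc k

    open Weight q

    q≤q^[1+M] : ∀ M → q ≤ q ^ suc M
    q≤q^[1+M] M = ≤-trans (≤-reflexive (sym (*-identityʳ q))) (*-monoʳ-≤ q (m^n>0 q M))

    q*q≤q^M : 2 ≤ M → q * q ≤ q ^ M
    q*q≤q^M 2≤M = ≤-trans (≤-reflexive (cong (q *_) (sym (*-identityʳ q)))) (^-monoʳ-≤ q 2≤M)

    n^M+q^[1+M]≤q*n^M+1 : ∀ M → n ^ M + q * q ^ M ≤ q * n ^ M + 1
    n^M+q^[1+M]≤q*n^M+1 zero = ≤-reflexive (+-comm 1 (q * 1))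
    n^M+q^[1+M]≤q*n^M+1 (suc M) = begin
      n * N + q * (q * Q)          ≡⟨ e₁ k N Q ⟩
      N + q * (N + q * Q)          ≤⟨ +-monoʳ-≤ N (*-monoʳ-≤ q (n^M+q^[1+M]≤q*n^M+1 M)) ⟩
      N + q * (q * N + 1)          ≡⟨ e₂ k N ⟩
      q * (q * N) + N + k * 1 + 1  ≤⟨ +-monoˡ-≤ 1 (+-monoʳ-≤ (q * (q * N) + N) (*-monoʳ-≤ k (m^n>0 n M))) ⟩
      q * (q * N) + N + k * N + 1  ≡⟨ e₃ k N ⟩
      q * (n * N) + 1              ∎
      where
      open ≤-Reasoning
      N = n ^ M
      Q = q ^ M
      e₁ : ∀ k N Q → suc (suc k) * N + suc k * (suc k * Q) ≡ N + suc k * (N + suc k * Q)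
      e₁ = solve-∀
      e₂ : ∀ k N → N + suc k * (suc k * N + 1) ≡ suc k * (suc k * N) + N + k * 1 + 1
      e₂ = solve-∀
      e₃ : ∀ k N → suc k * (suc k * N) + N + k * N + 1 ≡ suc k * (suc (suc k) * N) + 1
      e₃ = solve-∀

    pairWeight-bound-no-∁⁅⁆ : ∀ {X Y : SetSystem M} → CrossUpsets X Y → (∀ x → ¬ T (X (∁ ⁅ x ⁆))) →
                              weight X + weight Y + q ^ M ≤ n ^ M + 1
    pairWeight-bound-no-∁⁅⁆ {M} {X} {Y} P X∌∁⁅⁆ = begin
      weight X + weight Y + q ^ M    ≡⟨ +-assoc (weight X) (weight Y) (q ^ M) ⟩
      weight X + (weight Y + q ^ M)  ≤⟨ +-mono-≤ (only-⊤⇒weight≤1 X (∌∁⁅⁆⇒only-⊤ X upsetˡ X∌∁⁅⁆))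
                                                 (∌⊥⇒weight+q^M≤n^M Y Y∌⊥) ⟩
      1 + n ^ M                      ≡⟨ +-comm 1 (n ^ M) ⟩
      n ^ M + 1                      ∎
      where
      open CrossUpsets P
      open ≤-Reasoning
      Y∌⊥ : ¬ T (Y ⊥)
      Y∌⊥ = cross-∋⊤⇒∌⊥ Y X (cross-sym X Y cross) ⊤∈ˡ

    pairWeight-bound-common-∁⁅⁆ :
      ∀ {X Y : SetSystem (suc M)} →
      (∀ {X′ Y′ : SetSystem M} → CrossUpsets X′ Y′ → weight X′ + weight Y′ + q ^ M ≤ n ^ M + 1) →
      CrossUpsets X Y → ∀ z → T (X (∁ ⁅ z ⁆)) → T (Y (∁ ⁅ z ⁆)) →
      weight X + weight Y + q ^ suc M ≤ n ^ suc M + 1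
    pairWeight-bound-common-∁⁅⁆ {zero} _ P zero X∋∁⁅z⁆ _
      with CrossUpsets.cross P X∋∁⁅z⁆ (CrossUpsets.⊤∈ʳ P)
    ... | zero , ()
    pairWeight-bound-common-∁⁅⁆ {suc M} {X} {Y} bound P z X∋∁⁅z⁆ Y∋∁⁅z⁆
      rewrite weight-split X z | weight-split Y z =
      add-up k (weight X₀) (weight X₁) (weight Y₀) (weight Y₁) (q ^ suc M) (n ^ suc M)
        (bound (restrict P z refl (⟨inside⟩∋⊤ X z ⊤∈ˡ) (⟨outside⟩∋⊤ Y z Y∋∁⁅z⁆)))
        (bound (restrict P z refl (⟨outside⟩∋⊤ X z X∋∁⁅z⁆) (⟨inside⟩∋⊤ Y z ⊤∈ʳ)))
        (bound (restrict P z refl (⟨outside⟩∋⊤ X z X∋∁⁅z⁆) (⟨outside⟩∋⊤ Y z Y∋∁⁅z⁆)))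
        (q≤q^[1+M] M)
      where
      open CrossUpsets P
      X₀ X₁ Y₀ Y₁ : SetSystem (suc M)
      X₀ = X ⟨ z ≔ outside ⟩
      X₁ = X ⟨ z ≔ inside ⟩
      Y₀ = Y ⟨ z ≔ outside ⟩
      Y₁ = Y ⟨ z ≔ inside ⟩
      -- Add the first two bounds and k times the third, then cancel Q ≥ q.
      add-up : ∀ k x₀ x₁ y₀ y₁ Q N → x₁ + y₀ + Q ≤ N + 1 → x₀ + y₁ + Q ≤ N + 1 → x₀ + y₀ + Q ≤ N + 1 →
               suc k ≤ Q → (suc k * x₀ + x₁) + (suc k * y₀ + y₁) + suc k * Q ≤ suc (suc k) * N + 1
      add-up k x₀ x₁ y₀ y₁ Q N b₁₀ b₀₁ b₀₀ q≤Q = +-cancelʳ-≤ Q _ _ (begin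
        (suc k * x₀ + x₁) + (suc k * y₀ + y₁) + suc k * Q + Q
          ≡⟨ e₁ k x₀ x₁ y₀ y₁ Q ⟩
        (x₁ + y₀ + Q) + (x₀ + y₁ + Q) + k * (x₀ + y₀ + Q)
          ≤⟨ +-mono-≤ (+-mono-≤ b₁₀ b₀₁) (*-monoʳ-≤ k b₀₀) ⟩
        (N + 1) + (N + 1) + k * (N + 1)
          ≡⟨ e₂ k N ⟩
        suc (suc k) * N + 1 + suc k
          ≤⟨ +-monoʳ-≤ (suc (suc k) * N + 1) q≤Q ⟩
        suc (suc k) * N + 1 + Q ∎)
        where
        open ≤-Reasoning
        e₁ : ∀ k x₀ x₁ y₀ y₁ Q → (suc k * x₀ + x₁) + (suc k * y₀ + y₁) + suc k * Q + Q
                                 ≡ (x₁ + y₀ + Q) + (x₀ + y₁ + Q) + k * (x₀ + y₀ + Q)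
        e₁ = solve-∀
        e₂ : ∀ k N → (N + 1) + (N + 1) + k * (N + 1) ≡ suc (suc k) * N + 1 + suc k
        e₂ = solve-∀

    pairWeight-bound-separated : ∀ {X Y : SetSystem (suc M)} → CrossUpsets X Y → ∀ x y →
                                 ¬ T (X (∁ ⁅ y ⁆)) → ¬ T (Y (∁ ⁅ x ⁆)) →
                                 weight X + weight Y + q ^ suc M ≤ n ^ suc M + 1
    pairWeight-bound-separated {M} {X} {Y} P x y X∌∁⁅y⁆ Y∌∁⁅x⁆ = begin
      weight X + weight Y + q ^ suc M
        ≡⟨ cong₂ (λ a b → a + b + q ^ suc M)
                 (weight-⟨outside⟩-empty X y (∌∁⁅x⁆⇒⟨outside⟩-empty X y upsetˡ X∌∁⁅y⁆))
                 (weight-⟨outside⟩-empty Y x (∌∁⁅x⁆⇒⟨outside⟩-empty Y x upsetʳ Y∌∁⁅x⁆)) ⟩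
      weight (X ⟨ y ≔ inside ⟩) + weight (Y ⟨ x ≔ inside ⟩) + q ^ suc M
        ≤⟨ +-monoˡ-≤ (q ^ suc M) (+-mono-≤ (weight≤n^M (X ⟨ y ≔ inside ⟩)) (weight≤n^M (Y ⟨ x ≔ inside ⟩))) ⟩
      n ^ M + n ^ M + q * q ^ M
        ≡⟨ +-assoc (n ^ M) (n ^ M) (q * q ^ M) ⟩
      n ^ M + (n ^ M + q * q ^ M)
        ≤⟨ +-monoʳ-≤ (n ^ M) (n^M+q^[1+M]≤q*n^M+1 M) ⟩
      n ^ M + (q * n ^ M + 1)
        ≡⟨ +-assoc (n ^ M) (q * n ^ M) 1 ⟨
      n ^ suc M + 1 ∎
      where
      open CrossUpsets P
      open ≤-Reasoning

    pairWeight-bound : ∀ M {X Y : SetSystem M} → CrossUpsets X Y →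
                       weight X + weight Y + q ^ M ≤ n ^ M + 1
    pairWeight-bound zero P with CrossUpsets.cross P (CrossUpsets.⊤∈ˡ P) (CrossUpsets.⊤∈ʳ P)
    ... | () , _
    pairWeight-bound (suc M) {X} {Y} P with any? (λ z → T? (X (∁ ⁅ z ⁆) ∧ Y (∁ ⁅ z ⁆)))
    ... | yes (z , XY∋∁⁅z⁆) =
      let X∋∁⁅z⁆ , Y∋∁⁅z⁆ = to T-∧ XY∋∁⁅z⁆
      in pairWeight-bound-common-∁⁅⁆ (pairWeight-bound M) P z X∋∁⁅z⁆ Y∋∁⁅z⁆
    ... | no ∄z with any? (λ x → T? (X (∁ ⁅ x ⁆))) | any? (λ y → T? (Y (∁ ⁅ y ⁆)))
    ...   | no ∄x | _ = pairWeight-bound-no-∁⁅⁆ P (λ x X∋∁⁅x⁆ → ∄x (x , X∋∁⁅x⁆))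
    ...   | yes _ | no ∄y =
      ≤-trans (≤-reflexive (cong (_+ q ^ suc M) (+-comm (weight X) (weight Y))))
              (pairWeight-bound-no-∁⁅⁆ (swap P) (λ y Y∋∁⁅y⁆ → ∄y (y , Y∋∁⁅y⁆)))
    ...   | yes (x , X∋∁⁅x⁆) | yes (y , Y∋∁⁅y⁆) =
      pairWeight-bound-separated P x y (λ X∋∁⁅y⁆ → ∄z (y , from T-∧ (X∋∁⁅y⁆ , Y∋∁⁅y⁆)))
                            (λ Y∋∁⁅x⁆ → ∄z (x , from T-∧ (X∋∁⁅x⁆ , Y∋∁⁅x⁆)))

    combinedWeight : SetSystem M → SetSystem M → ℕ
    combinedWeight X Y = weight X + weight Y + k * weight (X ∩ᶠ Y)

    combinedWeight-comm : ∀ (X Y : SetSystem M) → combinedWeight X Y ≡ combinedWeight Y X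
    combinedWeight-comm X Y =
      cong₂ (λ a b → a + k * b) (+-comm (weight X) (weight Y))
            (weight-cong (X ∩ᶠ Y) (Y ∩ᶠ X) (λ s → ∧-comm (X s) (Y s)))

    combinedWeight-split :
      ∀ (X Y : SetSystem (suc M)) x → IsUpset X → IsUpset Y →
      combinedWeight X Y ≤ combinedWeight (X ⟨ x ≔ inside ⟩) (Y ⟨ x ≔ outside ⟩)
                         + combinedWeight (X ⟨ x ≔ outside ⟩) (Y ⟨ x ≔ inside ⟩)
                         + k * combinedWeight (X ⟨ x ≔ inside ⟩ ∩ᶠ Y ⟨ x ≔ inside ⟩)
                                              (X ⟨ x ≔ outside ⟩ ∪ᶠ Y ⟨ x ≔ outside ⟩)
    combinedWeight-split X Y x X↑ Y↑
      rewrite weight-split X x | weight-split Y x | weight-split (X ∩ᶠ Y) x =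
      rearrange k (weight X₀) (weight X₁) (weight Y₀) (weight Y₁) (weight (X₀ ∩ᶠ Y₀)) (weight (X₁ ∩ᶠ Y₁))
                (weight (X₁ ∩ᶠ Y₀)) (weight (X₀ ∩ᶠ Y₁)) (weight C) (weight (X₀ ∪ᶠ Y₀))
                (weight-modular X₀ Y₀) key
      where
      open ≤-Reasoning
      X₀ X₁ Y₀ Y₁ : SetSystem _
      X₀ = X ⟨ x ≔ outside ⟩
      X₁ = X ⟨ x ≔ inside ⟩
      Y₀ = Y ⟨ x ≔ outside ⟩
      Y₁ = Y ⟨ x ≔ inside ⟩
      X₀⊆X₁ : X₀ ⊆ᶠ X₁
      X₀⊆X₁ = ⟨outside⟩⊆⟨inside⟩ X x X↑
      Y₀⊆Y₁ : Y₀ ⊆ᶠ Y₁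
      Y₀⊆Y₁ = ⟨outside⟩⊆⟨inside⟩ Y x Y↑
      C D E : SetSystem _
      C = (X₁ ∩ᶠ Y₁) ∩ᶠ (X₀ ∪ᶠ Y₀)
      D = X₁ ∩ᶠ Y₀ ∪ᶠ X₀ ∩ᶠ Y₁
      E = (X₁ ∩ᶠ Y₀) ∩ᶠ (X₀ ∩ᶠ Y₁)
      X₀Y₀⊆E : X₀ ∩ᶠ Y₀ ⊆ᶠ E
      X₀Y₀⊆E XY₀s = let X₀s , Y₀s = to T-∧ XY₀s in
        from T-∧ (from T-∧ (X₀⊆X₁ X₀s , Y₀s) , from T-∧ (X₀s , Y₀⊆Y₁ Y₀s))
      X₀Y₀⊆D : X₀ ∩ᶠ Y₀ ⊆ᶠ D
      X₀Y₀⊆D XY₀s = let X₀s , Y₀s = to T-∧ XY₀s in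
        from T-∨ (inj₁ (from T-∧ (X₀⊆X₁ X₀s , Y₀s)))
      D⊆C : D ⊆ᶠ C
      D⊆C Ds with to T-∨ Ds
      ... | inj₁ XY₁₀s = let X₁s , Y₀s = to T-∧ XY₁₀s in
        from T-∧ (from T-∧ (X₁s , Y₀⊆Y₁ Y₀s) , from T-∨ (inj₂ Y₀s))
      ... | inj₂ XY₀₁s = let X₀s , Y₁s = to T-∧ XY₀₁s in
        from T-∧ (from T-∧ (X₀⊆X₁ X₀s , Y₁s) , from T-∨ (inj₁ X₀s))
      z₀ = weight (X₀ ∩ᶠ Y₀)
      key : z₀ + z₀ + k * z₀ ≤ weight (X₁ ∩ᶠ Y₀) + weight (X₀ ∩ᶠ Y₁) + k * weight C
      key = begin
        z₀ + z₀ + k * z₀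
          ≤⟨ +-mono-≤ (+-mono-≤ (weight-mono (X₀ ∩ᶠ Y₀) D X₀Y₀⊆D) (weight-mono (X₀ ∩ᶠ Y₀) E X₀Y₀⊆E))
                      (*-monoʳ-≤ k (weight-mono (X₀ ∩ᶠ Y₀) C (D⊆C ∘ X₀Y₀⊆D))) ⟩
        weight D + weight E + k * weight C
          ≡⟨ cong (_+ k * weight C) (weight-modular (X₁ ∩ᶠ Y₀) (X₀ ∩ᶠ Y₁)) ⟩
        weight (X₁ ∩ᶠ Y₀) + weight (X₀ ∩ᶠ Y₁) + k * weight C ∎
      rearrange : ∀ k x₀ x₁ y₀ y₁ z₀ z₁ a b c u → u + z₀ ≡ x₀ + y₀ → z₀ + z₀ + k * z₀ ≤ a + b + k * c →
                  (suc k * x₀ + x₁) + (suc k * y₀ + y₁) + k * (suc k * z₀ + z₁)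
                  ≤ (x₁ + y₀ + k * a) + (x₀ + y₁ + k * b) + k * (z₁ + u + k * c)
      rearrange k x₀ x₁ y₀ y₁ z₀ z₁ a b c u u+z₀≡x₀+y₀ z₀-bound = begin
        (suc k * x₀ + x₁) + (suc k * y₀ + y₁) + k * (suc k * z₀ + z₁)
          ≡⟨ e₁ k x₀ x₁ y₀ y₁ z₀ z₁ ⟩
        r + k * (x₀ + y₀) + k * (suc k * z₀)
          ≡⟨ cong (λ v → r + k * v + k * (suc k * z₀)) u+z₀≡x₀+y₀ ⟨
        r + k * (u + z₀) + k * (suc k * z₀)
          ≡⟨ e₂ k r u z₀ ⟩
        r + k * u + k * (z₀ + z₀ + k * z₀)
          ≤⟨ +-monoʳ-≤ (r + k * u) (*-monoʳ-≤ k z₀-bound) ⟩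
        r + k * u + k * (a + b + k * c)
          ≡⟨ e₃ k x₀ x₁ y₀ y₁ z₁ a b c u ⟩
        (x₁ + y₀ + k * a) + (x₀ + y₁ + k * b) + k * (z₁ + u + k * c) ∎
        where
        r = x₀ + x₁ + y₀ + y₁ + k * z₁
        e₁ : ∀ k x₀ x₁ y₀ y₁ z₀ z₁ → (suc k * x₀ + x₁) + (suc k * y₀ + y₁) + k * (suc k * z₀ + z₁)
                                     ≡ x₀ + x₁ + y₀ + y₁ + k * z₁ + k * (x₀ + y₀) + k * (suc k * z₀)
        e₁ = solve-∀
        e₂ : ∀ k r u z₀ → r + k * (u + z₀) + k * (suc k * z₀) ≡ r + k * u + k * (z₀ + z₀ + k * z₀)
        e₂ = solve-∀
        e₃ : ∀ k x₀ x₁ y₀ y₁ z₁ a b c u →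
             x₀ + x₁ + y₀ + y₁ + k * z₁ + k * u + k * (a + b + k * c)
             ≡ (x₁ + y₀ + k * a) + (x₀ + y₁ + k * b) + k * (z₁ + u + k * c)
        e₃ = solve-∀

    combinedWeight-bound-⁅⁆ : ∀ {X Y : SetSystem (suc M)} → CrossUpsets X Y →
                              ∀ y → T (Y ⁅ y ⁆) → ¬ T (X ⁅ y ⁆) →
                              combinedWeight X Y + q ^ suc M ≤ n ^ suc M + q
    combinedWeight-bound-⁅⁆ {M} {X} {Y} P y Y∋⁅y⁆ X∌⁅y⁆ = begin
      weight X + weight Y + k * weight (X ∩ᶠ Y) + q * q ^ M
        ≡⟨ cong₂ (λ a b → a + b + k * weight (X ∩ᶠ Y) + q * q ^ M) weight-X weight-Y ⟩
      weight X₁ + (q * weight Y₀ + n ^ M) + k * weight (X ∩ᶠ Y) + q * q ^ M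
        ≤⟨ +-monoˡ-≤ (q * q ^ M) (+-monoʳ-≤ (weight X₁ + (q * weight Y₀ + n ^ M))
                                            (*-monoʳ-≤ k weight-X∩Y)) ⟩
      weight X₁ + (q * weight Y₀ + n ^ M) + k * weight X₁ + q * q ^ M
        ≡⟨ e₁ k (weight X₁) (weight Y₀) (q ^ M) (n ^ M) ⟩
      q * (weight X₁ + weight Y₀ + q ^ M) + n ^ M
        ≤⟨ +-monoˡ-≤ (n ^ M) (*-monoʳ-≤ q restricted-bound) ⟩
      q * (n ^ M + 1) + n ^ M
        ≡⟨ e₂ k (n ^ M) ⟩
      n ^ suc M + q ∎
      where
      open CrossUpsets P
      open ≤-Reasoning
      X₁ Y₀ Y₁ : SetSystem M
      X₁ = X ⟨ y ≔ inside ⟩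
      Y₀ = Y ⟨ y ≔ outside ⟩
      Y₁ = Y ⟨ y ≔ inside ⟩
      weight-X : weight X ≡ weight X₁
      weight-X = weight-⟨outside⟩-empty X y (cross-∋⁅y⁆⇒⟨outside⟩-empty X Y y cross Y∋⁅y⁆)
      Y₁-full : ∀ s → T (Y₁ s)
      Y₁-full s = upsetʳ (insertAt-⊆ y b≤b ⊥⊆) (subst (T ∘ Y) (⁅x⁆≡insertAt⊥ y) Y∋⁅y⁆)
      weight-Y : weight Y ≡ q * weight Y₀ + n ^ M
      weight-Y = trans (weight-split Y y) (cong (q * weight Y₀ +_) (full⇒weight≡n^M Y₁ Y₁-full))
      weight-X∩Y : weight (X ∩ᶠ Y) ≤ weight X₁
      weight-X∩Y = ≤-trans (weight-mono (X ∩ᶠ Y) X (proj₁ ∘ to T-∧)) (≤-reflexive weight-X)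
      restricted-bound : weight X₁ + weight Y₀ + q ^ M ≤ n ^ M + 1
      restricted-bound with T? (Y (∁ ⁅ y ⁆))
      ... | yes Y∋∁⁅y⁆ =
        pairWeight-bound M (restrict P y refl (⟨inside⟩∋⊤ X y ⊤∈ˡ) (⟨outside⟩∋⊤ Y y Y∋∁⁅y⁆))
      ... | no Y∌∁⁅y⁆ = begin
        weight X₁ + weight Y₀ + q ^ M
          ≡⟨ cong (λ w → weight X₁ + w + q ^ M)
                  (empty⇒weight≡0 Y₀ (∌∁⁅x⁆⇒⟨outside⟩-empty Y y upsetʳ Y∌∁⁅y⁆)) ⟩
        weight X₁ + 0 + q ^ M
          ≡⟨ cong (_+ q ^ M) (+-identityʳ (weight X₁)) ⟩
        weight X₁ + q ^ M
          ≤⟨ ∌⊥⇒weight+q^M≤n^M X₁ (X∌⁅y⁆ ∘ subst (T ∘ X) (sym (⁅x⁆≡insertAt⊥ y))) ⟩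
        n ^ M
          ≤⟨ m≤m+n (n ^ M) 1 ⟩
        n ^ M + 1 ∎
      e₁ : ∀ k x₁ y₀ Q N → x₁ + (suc k * y₀ + N) + k * x₁ + suc k * Q ≡ suc k * (x₁ + y₀ + Q) + N
      e₁ = solve-∀
      e₂ : ∀ k N → suc k * (N + 1) + N ≡ suc (suc k) * N + suc k
      e₂ = solve-∀

    combinedWeight-bound-no-common-∁⁅⁆ : ∀ {X Y : SetSystem M} → CrossUpsets X Y →
                                         (∀ z → ¬ T ((X ∩ᶠ Y) (∁ ⁅ z ⁆))) →
                                         combinedWeight X Y + q ^ M ≤ n ^ M + q
    combinedWeight-bound-no-common-∁⁅⁆ {M} {X} {Y} P XY∌∁⁅⁆ = begin
      weight X + weight Y + k * weight (X ∩ᶠ Y) + q ^ M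
        ≡⟨ e₁ k (weight X) (weight Y) (weight (X ∩ᶠ Y)) (q ^ M) ⟩
      (weight X + weight Y + q ^ M) + k * weight (X ∩ᶠ Y)
        ≤⟨ +-mono-≤ (pairWeight-bound M P)
                    (*-monoʳ-≤ k (only-⊤⇒weight≤1 (X ∩ᶠ Y)
                      (∌∁⁅⁆⇒only-⊤ (X ∩ᶠ Y) (∩ᶠ-upset X Y upsetˡ upsetʳ) XY∌∁⁅⁆))) ⟩
      n ^ M + 1 + k * 1
        ≡⟨ e₂ k (n ^ M) ⟩
      n ^ M + q ∎
      where
      open CrossUpsets P
      open ≤-Reasoning
      e₁ : ∀ k x y z Q → x + y + k * z + Q ≡ (x + y + Q) + k * z
      e₁ = solve-∀
      e₂ : ∀ k N → N + 1 + k * 1 ≡ N + suc k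
      e₂ = solve-∀

    combinedWeight-bound-common-∁⁅⁆ :
      ∀ {X Y : SetSystem (suc M)} → 2 ≤ M →
      (∀ {X′ Y′ : SetSystem M} → CrossUpsets X′ Y′ → Sizes≥2 (X′ ∩ᶠ Y′) →
        combinedWeight X′ Y′ + q ^ M ≤ n ^ M + q) →
      CrossUpsets X Y → Sizes≥2 X → Sizes≥2 Y → ∀ z → T (X (∁ ⁅ z ⁆)) → T (Y (∁ ⁅ z ⁆)) →
      combinedWeight X Y + q ^ suc M ≤ n ^ suc M + q
    combinedWeight-bound-common-∁⁅⁆ {M} {X} {Y} 2≤M bound P X≥2 Y≥2 z X∋∁⁅z⁆ Y∋∁⁅z⁆ =
      add-up k (combinedWeight X Y) (combinedWeight X₁ Y₀) (combinedWeight X₀ Y₁)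
             (combinedWeight (X₁ ∩ᶠ Y₁) (X₀ ∪ᶠ Y₀)) (q ^ M) (n ^ M)
        (combinedWeight-split X Y z upsetˡ upsetʳ)
        (bound (restrict P z refl (⟨inside⟩∋⊤ X z ⊤∈ˡ) (⟨outside⟩∋⊤ Y z Y∋∁⁅z⁆))
               (Y₀≥2 ∘ proj₂ ∘ to T-∧))
        (bound (restrict P z refl (⟨outside⟩∋⊤ X z X∋∁⁅z⁆) (⟨inside⟩∋⊤ Y z ⊤∈ʳ))
               (X₀≥2 ∘ proj₁ ∘ to T-∧))
        (bound (restrict-∩∪ P z X∋∁⁅z⁆) X₀∪Y₀≥2)
        (q*q≤q^M 2≤M)
      where
      open CrossUpsets P
      X₀ X₁ Y₀ Y₁ : SetSystem M
      X₀ = X ⟨ z ≔ outside ⟩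
      X₁ = X ⟨ z ≔ inside ⟩
      Y₀ = Y ⟨ z ≔ outside ⟩
      Y₁ = Y ⟨ z ≔ inside ⟩
      X₀≥2 : Sizes≥2 X₀
      X₀≥2 = ⟨outside⟩-sizes≥2 X z X≥2
      Y₀≥2 : Sizes≥2 Y₀
      Y₀≥2 = ⟨outside⟩-sizes≥2 Y z Y≥2
      X₀∪Y₀≥2 : Sizes≥2 ((X₁ ∩ᶠ Y₁) ∩ᶠ (X₀ ∪ᶠ Y₀))
      X₀∪Y₀≥2 XYs with to T-∨ (proj₂ (to T-∧ XYs))
      ... | inj₁ X₀s = X₀≥2 X₀s
      ... | inj₂ Y₀s = Y₀≥2 Y₀s
      -- Add the first two bounds and k times the third, then cancel Q ≥ q * q.
      add-up : ∀ k t a b c Q N → t ≤ a + b + k * c →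
               a + Q ≤ N + suc k → b + Q ≤ N + suc k → c + Q ≤ N + suc k → suc k * suc k ≤ Q →
               t + suc k * Q ≤ suc (suc k) * N + suc k
      add-up k t a b c Q N t≤ a-bound b-bound c-bound q*q≤Q = +-cancelʳ-≤ Q _ _ (begin
        t + suc k * Q + Q
          ≤⟨ +-monoˡ-≤ Q (+-monoˡ-≤ (suc k * Q) t≤) ⟩
        a + b + k * c + suc k * Q + Q
          ≡⟨ e₁ k a b c Q ⟩
        (a + Q) + (b + Q) + k * (c + Q)
          ≤⟨ +-mono-≤ (+-mono-≤ a-bound b-bound) (*-monoʳ-≤ k c-bound) ⟩
        (N + suc k) + (N + suc k) + k * (N + suc k)
          ≡⟨ e₂ k N ⟩
        suc (suc k) * N + suc k + suc k * suc k
          ≤⟨ +-monoʳ-≤ (suc (suc k) * N + suc k) q*q≤Q ⟩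
        suc (suc k) * N + suc k + Q ∎)
        where
        open ≤-Reasoning
        e₁ : ∀ k a b c Q → a + b + k * c + suc k * Q + Q ≡ (a + Q) + (b + Q) + k * (c + Q)
        e₁ = solve-∀
        e₂ : ∀ k N → (N + suc k) + (N + suc k) + k * (N + suc k) ≡ suc (suc k) * N + suc k + suc k * suc k
        e₂ = solve-∀

    combinedWeight-bound : ∀ M {X Y : SetSystem M} → CrossUpsets X Y → Sizes≥2 (X ∩ᶠ Y) →
                           combinedWeight X Y + q ^ M ≤ n ^ M + q
    combinedWeight-bound zero P _ with CrossUpsets.cross P (CrossUpsets.⊤∈ˡ P) (CrossUpsets.⊤∈ʳ P)
    ... | () , _
    combinedWeight-bound (suc M) {X} {Y} P XY≥2
      with any? (λ y → T? (Y ⁅ y ⁆)) | any? (λ y → T? (X ⁅ y ⁆))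
    ... | yes (y , Y∋⁅y⁆) | _ =
      combinedWeight-bound-⁅⁆ P y Y∋⁅y⁆ (λ X∋⁅y⁆ → sizes≥2⇒∌⁅⁆ (X ∩ᶠ Y) XY≥2 y (from T-∧ (X∋⁅y⁆ , Y∋⁅y⁆)))
    ... | no _ | yes (y , X∋⁅y⁆) =
      ≤-trans (≤-reflexive (cong (_+ q ^ suc M) (combinedWeight-comm X Y)))
              (combinedWeight-bound-⁅⁆ (swap P) y X∋⁅y⁆
                (λ Y∋⁅y⁆ → sizes≥2⇒∌⁅⁆ (X ∩ᶠ Y) XY≥2 y (from T-∧ (X∋⁅y⁆ , Y∋⁅y⁆))))
    ... | no Y∌⁅⁆ | no X∌⁅⁆ with any? (λ z → T? ((X ∩ᶠ Y) (∁ ⁅ z ⁆)))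
    ...   | no ∄z = combinedWeight-bound-no-common-∁⁅⁆ P (λ z XY∋∁⁅z⁆ → ∄z (z , XY∋∁⁅z⁆))
    ...   | yes (z , XY∋∁⁅z⁆) =
      let X∋∁⁅z⁆ , Y∋∁⁅z⁆ = to T-∧ XY∋∁⁅z⁆ in
      combinedWeight-bound-common-∁⁅⁆ (subst (2 ≤_) (∣∁⁅x⁆∣≡n∸1 z) (XY≥2 XY∋∁⁅z⁆))
        (combinedWeight-bound M) P
        (∌⊥∌⁅⁆⇒sizes≥2 X (cross-∋⊤⇒∌⊥ X Y cross ⊤∈ʳ) (λ y X∋⁅y⁆ → X∌⁅⁆ (y , X∋⁅y⁆)))
        (∌⊥∌⁅⁆⇒sizes≥2 Y (cross-∋⊤⇒∌⊥ Y X (cross-sym X Y cross) ⊤∈ˡ) (λ y Y∋⁅y⁆ → Y∌⁅⁆ (y , Y∋⁅y⁆)))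
        z X∋∁⁅z⁆ Y∋∁⁅z⁆
      where open CrossUpsets P

    intersecting-weight-bound : ∀ M (X : SetSystem (suc M)) → IsUpset X → CrossIntersecting X X →
                                (∀ x → T (X (∁ ⁅ x ⁆))) → weight X + q ^ M ≤ n ^ M + q
    intersecting-weight-bound M X X↑ X×X X∋∁⁅⁆ = begin
      q * weight X₀ + weight X₁ + q ^ M        ≤⟨ +-monoˡ-≤ (q ^ M) weight≤combinedWeight ⟩
      combinedWeight X₁ X₀ + q ^ M             ≤⟨ combinedWeight-bound M P (X₀≥2 ∘ proj₂ ∘ to T-∧) ⟩
      n ^ M + q                                ∎
      where
      open ≤-Reasoning
      X₀ X₁ : SetSystem M
      X₀ = X ⟨ zero ≔ outside ⟩
      X₁ = X ⟨ zero ≔ inside ⟩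
      P : CrossUpsets X₁ X₀
      P = restrict record { upsetˡ = X↑ ; upsetʳ = X↑ ; cross = X×X ; ⊤∈ˡ = X∋⊤ ; ⊤∈ʳ = X∋⊤ } zero refl
                   (⟨inside⟩∋⊤ X zero X∋⊤) (⟨outside⟩∋⊤ X zero (X∋∁⁅⁆ zero))
        where
        X∋⊤ : T (X ⊤)
        X∋⊤ = X↑ ⊆⊤ (X∋∁⁅⁆ zero)
      X₀≥2 : Sizes≥2 X₀
      X₀≥2 = ⟨outside⟩-sizes≥2 X zero (intersecting-∋∁⁅⁆⇒sizes≥2 X X×X X∋∁⁅⁆)
      X₀⊆X₁∩X₀ : X₀ ⊆ᶠ X₁ ∩ᶠ X₀
      X₀⊆X₁∩X₀ X₀s = from T-∧ (⟨outside⟩⊆⟨inside⟩ X zero X↑ X₀s , X₀s)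
      weight≤combinedWeight : q * weight X₀ + weight X₁ ≤ combinedWeight X₁ X₀
      weight≤combinedWeight = begin
        q * weight X₀ + weight X₁
          ≡⟨ e k (weight X₁) (weight X₀) ⟩
        weight X₁ + weight X₀ + k * weight X₀
          ≤⟨ +-monoʳ-≤ (weight X₁ + weight X₀) (*-monoʳ-≤ k (weight-mono X₀ (X₁ ∩ᶠ X₀) X₀⊆X₁∩X₀)) ⟩
        weight X₁ + weight X₀ + k * weight (X₁ ∩ᶠ X₀) ∎
        where
        e : ∀ k a b → suc k * b + a ≡ a + b + k * b
        e = solve-∀

open SetSystems

private
  variable
    M : ℕ

module _ {A B C : Set} where

  length-cartesianProductWith : ∀ (f : A → B → C) xs ys →
                                length (cartesianProductWith f xs ys) ≡ length xs * length ys
  length-cartesianProductWith f []       ys = refl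
  length-cartesianProductWith f (x ∷ xs) ys =
    trans (length-++ (map (f x) ys))
          (cong₂ _+_ (length-map (f x) ys) (length-cartesianProductWith f xs ys))

module _ {A : Set} where

  ∈-─⁺ : ∀ {x y : A} {ys} (x∈ys : x ∈ ys) → y ∈ ys → y ≢ x → y ∈ ys ─ x∈ys
  ∈-─⁺ (Any.here refl) (Any.here refl) y≢x = contradiction refl y≢x
  ∈-─⁺ (Any.here refl) (Any.there y∈ys) _  = y∈ys
  ∈-─⁺ (Any.there x∈ys) (Any.here refl) _  = Any.here refl
  ∈-─⁺ (Any.there x∈ys) (Any.there y∈ys) y≢x = Any.there (∈-─⁺ x∈ys y∈ys y≢x)

  Unique-⊆⇒length≤ : ∀ {xs ys : List A} → Unique xs → (∀ {x} → x ∈ xs → x ∈ ys) → length xs ≤ length ys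
  Unique-⊆⇒length≤ {[]}     _              _     = z≤n
  Unique-⊆⇒length≤ {x ∷ xs} {ys} (x∉xs ∷ xs!) xs⊆ys =
    ≤-trans (s≤s (Unique-⊆⇒length≤ xs! xs⊆ys─x)) (≤-reflexive (sym (length-removeAt′ ys (Any.index x∈ys))))
    where
    x∈ys : x ∈ ys
    x∈ys = xs⊆ys (Any.here refl)
    xs⊆ys─x : ∀ {y} → y ∈ xs → y ∈ ys ─ x∈ys
    xs⊆ys─x y∈xs = ∈-─⁺ x∈ys (xs⊆ys (Any.there y∈xs)) (All.lookup x∉xs y∈xs ∘ sym)

  1≤length⇒∃∈ : ∀ (xs : List A) → 1 ≤ length xs → ∃ λ x → x ∈ xs
  1≤length⇒∃∈ (x ∷ _) _ = x , Any.here refl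

module Counting (q : ℕ) where

  open Weight q

  tuplesIn : SetSystem M → List (Vec (Fin n) M)
  tuplesIn {zero}  X = if X [] then [ [] ] else []
  tuplesIn {suc M} X = cartesianProductWith _∷_ (map suc (allFin q)) (tuplesIn (X ⟨ zero ≔ outside ⟩))
                       ++ map (zero ∷_) (tuplesIn (X ⟨ zero ≔ inside ⟩))

  length-tuplesIn : ∀ (X : SetSystem M) → length (tuplesIn X) ≡ weight X
  length-tuplesIn {zero} X with X []
  ... | true  = refl
  ... | false = refl
  length-tuplesIn {suc M} X = begin
    length (cartesianProductWith _∷_ (map suc (allFin q)) (tuplesIn X₀) ++ map (zero ∷_) (tuplesIn X₁))
      ≡⟨ length-++ (cartesianProductWith _∷_ (map suc (allFin q)) (tuplesIn X₀)) ⟩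
    length (cartesianProductWith _∷_ (map suc (allFin q)) (tuplesIn X₀)) + length (map (zero ∷_) (tuplesIn X₁))
      ≡⟨ cong₂ _+_ (length-cartesianProductWith _∷_ (map suc (allFin q)) (tuplesIn X₀))
                   (length-map (zero ∷_) (tuplesIn X₁)) ⟩
    length (map suc (allFin q)) * length (tuplesIn X₀) + length (tuplesIn X₁)
      ≡⟨ cong₂ (λ a b → a * length (tuplesIn X₀) + b)
               (trans (length-map suc (allFin q)) (length-tabulate {n = q} (λ i → i)))
               (length-tuplesIn X₁) ⟩
    q * length (tuplesIn X₀) + weight X₁
      ≡⟨ cong (λ w → q * w + weight X₁) (length-tuplesIn X₀) ⟩
    q * weight X₀ + weight X₁ ∎
    where
    open ≡-Reasoning
    X₀ X₁ : SetSystem M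
    X₀ = X ⟨ zero ≔ outside ⟩
    X₁ = X ⟨ zero ≔ inside ⟩

  ∈-tuplesIn : ∀ (X : SetSystem M) (A : Vec (Fin n) M) → T (X (ones A)) → A ∈ tuplesIn X
  ∈-tuplesIn {zero} X [] X∋ with X []
  ... | true = Any.here refl
  ∈-tuplesIn {suc M} X (zero ∷ A) X∋ =
    ∈-++⁺ʳ (cartesianProductWith _∷_ (map suc (allFin q)) (tuplesIn (X ⟨ zero ≔ outside ⟩)))
           (∈-map⁺ (zero ∷_) (∈-tuplesIn (X ⟨ zero ≔ inside ⟩) A X∋))
  ∈-tuplesIn {suc M} X (suc a ∷ A) X∋ =
    ∈-++⁺ˡ (∈-cartesianProductWith⁺ _∷_ (∈-map⁺ suc (∈-allFin a)) (∈-tuplesIn (X ⟨ zero ≔ outside ⟩) A X∋))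

module _ {r m : ℕ} where

  lookup-resetAll-∈ : ∀ (A : Tuple r (suc m)) {i} S → i ∈ S → lookup (foldr reset A S) i ≡ zero
  lookup-resetAll-∈ A {i} (ℓ ∷ S) (Any.here refl) = lookup∘update i (foldr reset A S) zero
  lookup-resetAll-∈ A {i} (ℓ ∷ S) (Any.there i∈S) with i FinP.≟ ℓ
  ... | yes refl = lookup∘update i (foldr reset A S) zero
  ... | no i≢ℓ  = trans (lookup∘update′ i≢ℓ (foldr reset A S) zero) (lookup-resetAll-∈ A S i∈S)

  lookup-resetAll-∉ : ∀ (A : Tuple r (suc m)) {i} S → i ∉ S → lookup (foldr reset A S) i ≡ lookup A i
  lookup-resetAll-∉ A []      _   = refl
  lookup-resetAll-∉ A (ℓ ∷ S) i∉S =
    trans (lookup∘update′ (i∉S ∘ Any.here) (foldr reset A S) zero) (lookup-resetAll-∉ A S (i∉S ∘ Any.there))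

module _ {r m : ℕ} (F : Family r (suc m)) where

  shiftElem-reset : ∀ ℓ j A → lookup A ℓ ≡ j → reset ℓ A ∉ F → shiftElem ℓ j F A ≡ reset ℓ A
  shiftElem-reset ℓ j A Aℓ≡j A′∉F with lookup A ℓ FinP.≟ j | reset ℓ A ∈? F
  ... | yes _    | no _     = refl
  ... | yes _    | yes A′∈F = contradiction A′∈F A′∉F
  ... | no Aℓ≢j | _        = contradiction Aℓ≡j Aℓ≢j

  reset-closed : Shifted F → ∀ ℓ {A} → A ∈ F → reset ℓ A ∈ F
  reset-closed shifted ℓ {A} A∈F with lookup A ℓ in Aℓ≡
  ... | zero = subst (_∈ F) (sym (trans (cong (A [ ℓ ]≔_) (sym Aℓ≡)) ([]≔-lookup A ℓ))) A∈F
  ... | suc j with reset ℓ A ∈? F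
  ...   | yes A′∈F = A′∈F
  ...   | no A′∉F =
    proj₁ (shifted ℓ (suc j) (s≤s z≤n) (reset ℓ A))
          (subst (_∈ shift ℓ (suc j) F) (shiftElem-reset ℓ (suc j) A Aℓ≡ A′∉F)
                 (∈-map⁺ (shiftElem ℓ (suc j) F) A∈F))

  resetAll-closed : Shifted F → ∀ S {A} → A ∈ F → foldr reset A S ∈ F
  resetAll-closed shifted []      A∈F = A∈F
  resetAll-closed shifted (ℓ ∷ S) A∈F = reset-closed shifted ℓ (resetAll-closed shifted S A∈F)

  -- Reset in A every coordinate where B is not 1: the result is still in F, so it meets B,
  -- and it can only do so at a coordinate where B, and hence A, is 1.
  common-one : Shifted F → Intersecting F → ∀ {A B} → A ∈ F → B ∈ F →
               ∃ λ ℓ → lookup A ℓ ≡ zero × lookup B ℓ ≡ zero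
  common-one shifted intersecting {A} {B} A∈F B∈F = ℓ , Aℓ≡0 , Bℓ≡0
    where
    B≢0? = λ i → ¬? (lookup B i FinP.≟ zero)
    S = filter B≢0? (allFin r)
    A′ = foldr reset A S
    A′∩B = 1≤length⇒∃∈ _ (intersecting A′ B (resetAll-closed shifted S A∈F) B∈F)
    ℓ = proj₁ A′∩B
    A′ℓ≡Bℓ : lookup A′ ℓ ≡ lookup B ℓ
    A′ℓ≡Bℓ = proj₂ (∈-filter⁻ (λ i → lookup A′ i FinP.≟ lookup B i) {xs = allFin r} (proj₂ A′∩B))
    Bℓ≡0 : lookup B ℓ ≡ zero
    Bℓ≡0 = decidable-stable (lookup B ℓ FinP.≟ zero) λ Bℓ≢0 →
      Bℓ≢0 (trans (sym A′ℓ≡Bℓ) (lookup-resetAll-∈ A S (∈-filter⁺ B≢0? (∈-allFin ℓ) Bℓ≢0)))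
    Aℓ≡0 : lookup A ℓ ≡ zero
    Aℓ≡0 = trans (sym (lookup-resetAll-∉ A S (λ ℓ∈S → proj₂ (∈-filter⁻ B≢0? {xs = allFin r} ℓ∈S) Bℓ≡0)))
                 (trans A′ℓ≡Bℓ Bℓ≡0)

  ⋂-empty⇒not-one : length (⋂ F) < 1 → ∀ ℓ → ∃ λ A → A ∈ F × lookup A ℓ ≢ zero
  ⋂-empty⇒not-one ⋂F-empty ℓ with Any.any? (λ A → ¬? (lookup A ℓ FinP.≟ zero)) F
  ... | yes ∃A = find ∃A
  ... | no ∄A = contradiction (∈-length ℓ∈⋂F) (<⇒≱ ⋂F-empty)
    where
    one-at-ℓ : ∀ {A} → A ∈ F → lookup A ℓ ≡ zero
    one-at-ℓ {A} A∈F = decidable-stable (lookup A ℓ FinP.≟ zero) (∄A ∘ lose A∈F)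
    ℓ∈⋂F : ℓ ∈ ⋂ F
    ℓ∈⋂F = ∈-filter⁺ (λ ℓ → All.all? (λ A → All.all? (λ B → lookup A ℓ FinP.≟ lookup B ℓ) F) F) (∈-allFin ℓ)
             (All.tabulate λ A∈F → All.tabulate λ B∈F → trans (one-at-ℓ A∈F) (sym (one-at-ℓ B∈F)))

  ones↑ : SetSystem r
  ones↑ s = ⌊ Any.any? (λ A → ones A ⊆? s) F ⌋

  ones↑⁺ : ∀ {A s} → A ∈ F → ones A ⊆ s → T (ones↑ s)
  ones↑⁺ {s = s} A∈F ones⊆s = fromWitness (lose {P = λ B → ones B ⊆ s} A∈F ones⊆s)

  ones↑⁻ : ∀ {s} → T (ones↑ s) → ∃ λ A → A ∈ F × ones A ⊆ s
  ones↑⁻ = find ∘ toWitness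

  ones↑-upset : IsUpset ones↑
  ones↑-upset s⊆t F∋s = let A , A∈F , ones⊆s = ones↑⁻ F∋s in ones↑⁺ A∈F (s⊆t ∘ ones⊆s)

  ones↑-intersecting : Shifted F → Intersecting F → CrossIntersecting ones↑ ones↑
  ones↑-intersecting shifted intersecting F∋s F∋t =
    let A , A∈F , onesA⊆s = ones↑⁻ F∋s
        B , B∈F , onesB⊆t = ones↑⁻ F∋t
        ℓ , Aℓ≡0 , Bℓ≡0   = common-one shifted intersecting A∈F B∈F
    in Nonempty-∩-mono onesA⊆s onesB⊆t (ones-∩-Nonempty A B ℓ Aℓ≡0 Bℓ≡0)

  ones↑-∋∁⁅⁆ : length (⋂ F) < 1 → ∀ ℓ → T (ones↑ (∁ ⁅ ℓ ⁆))
  ones↑-∋∁⁅⁆ ⋂F-empty ℓ = let A , A∈F , Aℓ≢0 = ⋂-empty⇒not-one ⋂F-empty ℓ in ones↑⁺ A∈F (ones⊆∁⁅⁆ A ℓ Aℓ≢0)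

  length≤weight-ones↑ : Unique F → length F ≤ Weight.weight m ones↑
  length≤weight-ones↑ F! = ≤-trans (Unique-⊆⇒length≤ F! F⊆tuplesIn) (≤-reflexive (length-tuplesIn ones↑))
    where
    open Counting m
    F⊆tuplesIn : ∀ {A} → A ∈ F → A ∈ tuplesIn ones↑
    F⊆tuplesIn A∈F = ∈-tuplesIn ones↑ _ (ones↑⁺ A∈F (λ x → x))

shifted-intersecting-bound : ∀ k R (F : Family (suc R) (suc (suc k))) →
                             Unique F → Shifted F → Intersecting F → length (⋂ F) < 1 →
                             length F + suc k ^ R ≤ suc (suc k) ^ R + suc k
shifted-intersecting-bound k R F F! shifted intersecting ⋂F-empty =
  ≤-trans (+-monoˡ-≤ (suc k ^ R) (length≤weight-ones↑ F F!))
          (intersecting-weight-bound R (ones↑ F) (ones↑-upset F) (ones↑-intersecting F shifted intersecting)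
                                      (ones↑-∋∁⁅⁆ F ⋂F-empty))
  where open Bounds k

lemma2p5 : (r n : ℕ) → .{{_ : NonZero n}} → 3 ≤ r → 2 ≤ n →
    (F : Family r n) → Unique F →
    Shifted F → Intersecting F → length (⋂ F) < 1 →
    ((G : Family r n) → Unique G → Shifted G → Intersecting G → length (⋂ G) < 1 →
      length G ≤ length F) →
    length F ≤ n ^ (r ∸ 1) ∸ (n ∸ 1) ^ (r ∸ 1) + (n ∸ 1)
lemma2p5 _ _ (s≤s {n = R} _) (s≤s (s≤s {n = k} _)) F F! shifted intersecting ⋂F-empty _ =
  ≤-trans (m+n≤o⇒m≤o∸n (length F) (shifted-intersecting-bound k R F F! shifted intersecting ⋂F-empty))
          (≤-reflexive (+-∸-comm (suc k) (^-monoˡ-≤ R (n≤1+n (suc k)))))
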